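{- If $T$ is a tree with $n$ vertices, then $\nu^*(P_n)\le \nu^*(T)\le \nu^*(K_{1,n-1})$, where $P_n$ is the path with $n$ vertices and $K_{1,n-1}$ is the star with $n$ vertices.
   Context: For a finite simple graph $G=(V,E)$ with $p=|V|$, $q=|E|$, $\ell=p+q$, a construction sequence (c-sequence) for $G$ is a bijection $x:\{1,\dots,\ell\}\to V\sqcup E$ such that for every edge $e=uw$, $x^{ -1}(e)>\max\{x^{ -1}(u),x^{ -1}(w)\}$. The cost of an edge $e=uw$ in $x$ is $\nu(e,x)=(x^{ -1}(e)-x^{ -1}(u))+(x^{ -1}(e)-x^{ -1}(w))$, and the cost of $x$ is $\nu(x)=\sum_{e\in E}\nu(e,x)$. The max cost of $G$ is $\nu^*(G)=\max\nu(x)$ over all c-sequences $x$ for $G$. -}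

module Defs where

open import Data.Nat using (ℕ; zero; suc; _+_; _∸_; _≤_; _<_)
open import Data.Fin using (Fin; toℕ) renaming (_<_ to _<ᶠ_)
open import Data.Fin.Base using () renaming (zero to fzero; suc to fsuc)
open import Data.Bool using (Bool; true; false; _∧_; not; _xor_)
open import Data.List using (List; []; _∷_; length; map; allFin)
open import Data.Nat.ListAction using (sum)
open import Data.List.Relation.Unary.Unique.Propositional using (Unique)
open import Data.Sum using (_⊎_; inj₁; inj₂)
open import Data.Product using (Σ; ∃; ∃-syntax; _×_; _,_; proj₁; proj₂)
open import Relation.Binary.PropositionalEquality using (_≡_; refl) renaming (sym to sym≡)
open import Relation.Nullary using (yes; no)
open import Data.Empty using (⊥; ⊥-elim)
import Data.Bool.Properties as BP
import Data.Nat.Properties as NP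
open import Relation.Nullary.Decidable using (⌊_⌋)
open import Function.Bundles using (_↔_; Inverse)
import Data.Nat as N
import Data.Fin as F

record SimpleGraph (n : ℕ) : Set where
  field
    adj   : Fin n → Fin n → Bool
    sym   : ∀ i j → adj i j ≡ adj j i
    irref : ∀ i → adj i i ≡ false
open SimpleGraph public

-- Edges: unordered pairs {i,j}, represented canonically with i < j.
record Edge {n} (G : SimpleGraph n) : Set where
  constructor edge
  field
    endL  : Fin n
    endR  : Fin n
    ordered : endL <ᶠ endR
    isAdj : adj G endL endR ≡ true
open Edge public

Elem : ∀ {n} → SimpleGraph n → Set
Elem {n} G = Fin n ⊎ Edge G

-- A construction sequence: a bijection from {1..ℓ} (here Fin ℓ, 0-based;
-- only differences of positions matter) onto V ⊔ E, such that every edge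
-- comes after both of its endpoints.  ℓ is forced to be p + q.
record CSeq {n} (G : SimpleGraph n) : Set where
  field
    len   : ℕ
    seq   : Fin len ↔ Elem G
  pos : Elem G → ℕ
  pos a = toℕ (Inverse.from seq a)
  field
    edgeAfterL : ∀ (e : Edge G) → pos (inj₁ (endL e)) < pos (inj₂ e)
    edgeAfterR : ∀ (e : Edge G) → pos (inj₁ (endR e)) < pos (inj₂ e)
open CSeq public

elemCost : ∀ {n} {G : SimpleGraph n} → CSeq G → Elem G → ℕ
elemCost x (inj₁ _) = 0
elemCost x (inj₂ e) =
  (pos x (inj₂ e) ∸ pos x (inj₁ (endL e))) + (pos x (inj₂ e) ∸ pos x (inj₁ (endR e)))

cost : ∀ {n} {G : SimpleGraph n} → CSeq G → ℕ
cost x = sum (map (λ k → elemCost x (Inverse.to (seq x) k)) (allFin (len x)))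

IsMaxCost : ∀ {n} → SimpleGraph n → ℕ → Set
IsMaxCost G m = (Σ (CSeq G) λ x → cost x ≡ m) × (∀ (x : CSeq G) → cost x ≤ m)

data Walk {n} (G : SimpleGraph n) : Fin n → Fin n → Set where
  here : ∀ {u} → Walk G u u
  step : ∀ {u v w} → adj G u v ≡ true → Walk G v w → Walk G u w

Connected : ∀ {n} → SimpleGraph n → Set
Connected {n} G = ∀ (u v : Fin n) → Walk G u v

adjChain : ∀ {n} → SimpleGraph n → Fin n → List (Fin n) → Fin n → Set
adjChain G a [] z = adj G a z ≡ true
adjChain G a (b ∷ bs) z = (adj G a b ≡ true) × adjChain G b bs z

HasCycle : ∀ {n} → SimpleGraph n → Set
HasCycle {n} G = Σ (Fin n) λ v → Σ (List (Fin n)) λ bs →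
  (2 ≤ length bs) × Unique (v ∷ bs) × adjChain G v bs v

Acyclic : ∀ {n} → SimpleGraph n → Set
Acyclic G = HasCycle G → ⊥

IsTree : ∀ {n} → SimpleGraph n → Set
IsTree G = Connected G × Acyclic G

pathAdj : ∀ {n} → Fin n → Fin n → Bool
pathAdj i j = ⌊ suc (toℕ i) N.≟ toℕ j ⌋ Data.Bool.∨ ⌊ suc (toℕ j) N.≟ toℕ i ⌋

isCentre : ∀ {n} → Fin n → Bool
isCentre i = ⌊ toℕ i N.≟ 0 ⌋

pathAdj-sym : ∀ {n} (i j : Fin n) → pathAdj i j ≡ pathAdj j i
pathAdj-sym i j = BP.∨-comm ⌊ suc (toℕ i) N.≟ toℕ j ⌋ ⌊ suc (toℕ j) N.≟ toℕ i ⌋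

pathAdj-irr : ∀ {n} (i : Fin n) → pathAdj i i ≡ false
pathAdj-irr i with suc (toℕ i) N.≟ toℕ i
... | yes p = ⊥-elim (NP.1+n≢n p)
... | no _ = refl

Path : ∀ n → SimpleGraph n
Path n = record { adj = pathAdj ; sym = pathAdj-sym ; irref = pathAdj-irr }

starAdj : ∀ {n} → Fin n → Fin n → Bool
starAdj i j = isCentre i xor isCentre j

starAdj-sym : ∀ {n} (i j : Fin n) → starAdj i j ≡ starAdj j i
starAdj-sym i j = BP.xor-comm (isCentre i) (isCentre j)

starAdj-irr : ∀ {n} (i : Fin n) → starAdj i i ≡ false
starAdj-irr i = BP.xor-same (isCentre i)

Star : ∀ n → SimpleGraph n
Star n = record { adj = starAdj ; sym = starAdj-sym ; irref = starAdj-irr }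

-- Number the elements of a c-sequence from 0.  An edge uw at position p costs
-- (p - pos u) + (p - pos w), and the p + q elements occupy positions
-- 0, ..., p + q - 1, so
--   ν(x) + 2 Σ_v pos v + Σ_{uw ∈ E} (pos u + pos w) = 2 (0 + 1 + ... + (p + q - 1)).
-- The vertex sum is at least 0 + 1 + ... + (p - 1).  Every vertex of a tree is an
-- endpoint, so the endpoint sum is at least the vertex sum; in the path the p - 2
-- inner vertices are endpoints twice, which adds at least 0 + 1 + ... + (p - 3).
-- Listing the vertices first attains the first bound for the star, and attains the
-- second for a tree whose vertices are listed in the reverse of a leaf-pruning
-- order in which every parent is pruned at least two steps after its child.
module Submission where

open import Defs hiding (sym)
open import Axiom.UniquenessOfIdentityProofs using (module Decidable⇒UIP)
open import Data.Bool using (true)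
import Data.Bool.Properties as Bool
open import Data.Empty using (⊥)
open import Data.Fin using (Fin; toℕ; _↑ˡ_; _↑ʳ_; punchIn; punchOut; inject₁; fromℕ; fromℕ<; opposite)
  renaming (zero to fzero; suc to fsuc; _<_ to _<ᶠ_)
import Data.Fin.Properties as Fin
open import Data.Fin.Permutation using (↔⇒≡; insert; insert-punchIn; reverse)
open import Data.List using (List; []; _∷_)
import Data.List as List using (tabulate; map; length; _++_)
import Data.List.Properties as List using (map-tabulate; length-map; length-++; ++-assoc)
open import Data.List.Membership.Propositional using (_∈_)
open import Data.List.Membership.Propositional.Properties using (∈-∃++)
open import Data.List.Relation.Unary.All using (All; []; _∷_; lookup)
import Data.List.Relation.Unary.All.Properties as All
open import Data.List.Relation.Unary.AllPairs using ([]; _∷_)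
open import Data.List.Relation.Unary.Any using (here; there)
open import Data.List.Relation.Unary.Unique.Propositional using (Unique)
import Data.List.Relation.Unary.Unique.Propositional.Properties as Unique
open import Data.Nat using (ℕ; zero; suc; _+_; _∸_; _≤_; _<_; z≤n; s≤s; s≤s⁻¹; _≤?_)
open import Data.Nat.ListAction using () renaming (sum to listSum)
import Data.Nat.Properties as ℕ
open import Data.Nat.Tactic.RingSolver using (solve-∀)
open import Data.Product using (Σ; _×_; _,_; proj₁; proj₂)
open import Data.Sum using (_⊎_; inj₁; inj₂)
import Data.Sum as Sum
open import Data.Sum.Function.Propositional using (_⊎-↔_)
open import Data.Sum.Properties using (inj₁-injective)
open import Data.Unit using (⊤; tt)
open import Function using (_∘_; id)
open import Function.Bundles using (_↔_; Inverse; mk↔ₛ′)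
open import Function.Construct.Composition using (_↔-∘_)
open import Function.Construct.Identity using (↔-id)
open import Function.Construct.Symmetry using (↔-sym)
open import Function.Definitions using (Injective)
open import Relation.Binary.Definitions using (tri<; tri≈; tri>)
open import Relation.Binary.PropositionalEquality
  using (_≡_; _≢_; refl; sym; trans; cong; cong₂; subst; subst₂; module ≡-Reasoning)
open import Relation.Nullary using (yes; no; ¬?; contradiction)
open import Relation.Nullary.Decidable using (_×-dec_)

open import Algebra.Properties.CommutativeMonoid.Sum ℕ.+-0-commutativeMonoid
  using (sum; sum-syntax; sum-cong-≗; sum-permute; sum-remove; sum-replicate-zero; sum-init-last; ∑-distrib-+)
open import Algebra.Properties.CommutativeSemigroup ℕ.+-commutativeSemigroup using (x∙yz≈y∙xz)

open Inverse using (to; from; strictlyInverseˡ; strictlyInverseʳ)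

-- Sums over Fin

triangular : ℕ → ℕ
triangular n = ∑[ i < n ] toℕ i

sum-mono-≤ : ∀ {n} {f g : Fin n → ℕ} → (∀ i → f i ≤ g i) → sum f ≤ sum g
sum-mono-≤ {zero}  f≤g = z≤n
sum-mono-≤ {suc n} f≤g = ℕ.+-mono-≤ (f≤g fzero) (sum-mono-≤ (f≤g ∘ fsuc))

sum-suc : ∀ {n} (f : Fin n → ℕ) → ∑[ i < n ] suc (f i) ≡ n + sum f
sum-suc {zero}  f = refl
sum-suc {suc n} f =
  cong suc (trans (cong (f fzero +_) (sum-suc (f ∘ fsuc))) (x∙yz≈y∙xz (f fzero) n _))

triangular-suc : ∀ n → triangular (suc n) ≡ n + triangular n
triangular-suc n = sum-suc {n} toℕ

sum-complement : ∀ n → ∑[ j < n ] (n ∸ toℕ j) ≡ triangular (suc n)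
sum-complement zero    = refl
sum-complement (suc n) = trans (cong (suc n +_) (sum-complement n)) (sym (triangular-suc (suc n)))

sum-complement-suc : ∀ n → ∑[ j < suc n ] (n ∸ suc (toℕ j)) ≡ triangular n
sum-complement-suc zero    = refl
sum-complement-suc (suc n) = trans (cong (n +_) (sum-complement-suc n)) (sym (triangular-suc n))

≤-sum : ∀ {n} (f : Fin n → ℕ) i → f i ≤ sum f
≤-sum {suc n} f i = subst (f i ≤_) (sym (sum-remove {i = i} f)) (ℕ.m≤m+n (f i) _)

sum-splitAt : ∀ n {m} (f : Fin (n + m) → ℕ) →
  sum f ≡ ∑[ i < n ] f (i ↑ˡ m) + ∑[ j < m ] f (n ↑ʳ j)
sum-splitAt zero    f = refl
sum-splitAt (suc n) f =
  trans (cong (f fzero +_) (sum-splitAt n (f ∘ fsuc))) (sym (ℕ.+-assoc (f fzero) _ _))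

argmin : ∀ {n} (f : Fin (suc n) → ℕ) → Σ (Fin (suc n)) λ i → ∀ j → f i ≤ f j
argmin {zero}  f = fzero , λ { fzero → ℕ.≤-refl }
argmin {suc n} f with argmin (f ∘ fsuc)
... | i , fi≤ with f fzero ≤? f (fsuc i)
...   | yes f0≤fi = fzero , λ { fzero → ℕ.≤-refl ; (fsuc j) → ℕ.≤-trans f0≤fi (fi≤ j) }
...   | no  f0≰fi = fsuc i , λ { fzero → ℕ.<⇒≤ (ℕ.≰⇒> f0≰fi) ; (fsuc j) → fi≤ j }

-- Remove a minimal value; the others are all positive, so lower them by one.
triangular≤sum : ∀ n (f : Fin n → ℕ) → Injective _≡_ _≡_ f → triangular n ≤ sum f
triangular≤sum zero    f f-inj = z≤n
triangular≤sum (suc n) f f-inj with argmin f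
... | i , fi≤ = begin
  triangular (suc n)                     ≡⟨ triangular-suc n ⟩
  n + triangular n                       ≤⟨ ℕ.+-monoʳ-≤ n (triangular≤sum n g g-inj) ⟩
  n + sum g                              ≡⟨ sym (sum-suc g) ⟩
  ∑[ j < n ] suc (g j)                   ≡⟨ sum-cong-≗ (sym ∘ f≡suc∘g) ⟩
  ∑[ j < n ] f (punchIn i j)             ≤⟨ ℕ.m≤n+m _ (f i) ⟩
  f i + ∑[ j < n ] f (punchIn i j)       ≡⟨ sym (sum-remove {i = i} f) ⟩
  sum f                                  ∎
  where
  open ℕ.≤-Reasoning
  fi<f : ∀ j → f i < f (punchIn i j)
  fi<f j = ℕ.≤∧≢⇒< (fi≤ (punchIn i j)) (Fin.punchInᵢ≢i i j ∘ sym ∘ f-inj)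
  g : Fin n → ℕ
  g j = f (punchIn i j) ∸ 1
  f≡suc∘g : ∀ j → f (punchIn i j) ≡ suc (g j)
  f≡suc∘g j = sym (ℕ.m+[n∸m]≡n (ℕ.≤-trans (s≤s z≤n) (fi<f j)))
  g-inj : Injective _≡_ _≡_ g
  g-inj {j} {k} gj≡gk =
    Fin.punchIn-injective i j k (f-inj (trans (f≡suc∘g j) (trans (cong suc gj≡gk) (sym (f≡suc∘g k)))))

-- The cost formula

sum-tabulate : ∀ {n} (g : Fin n → ℕ) → listSum (List.tabulate g) ≡ sum g
sum-tabulate {zero}  g = refl
sum-tabulate {suc n} g = cong (g fzero +_) (sum-tabulate (g ∘ fsuc))

cost≡sum : ∀ {n} {G : SimpleGraph n} (x : CSeq G) →
  cost x ≡ ∑[ k < len x ] elemCost x (to (seq x) k)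
cost≡sum x = trans (cong listSum (List.map-tabulate {n = len x} id elemCostAt)) (sum-tabulate elemCostAt)
  where
  elemCostAt : Fin (len x) → ℕ
  elemCostAt k = elemCost x (to (seq x) k)

verticesThenEdges : ∀ {n m} {G : SimpleGraph n} →
  Fin n ↔ Fin n → Fin m ↔ Edge G → Fin (n + m) ↔ Elem G
verticesThenEdges σ E = (σ ⊎-↔ E) ↔-∘ Fin.+↔⊎

module _ {n m} {G : SimpleGraph n} (σ : Fin n ↔ Fin n) (E : Fin m ↔ Edge G) where

  verticesThenEdges-↑ˡ : ∀ i → to (verticesThenEdges σ E) (i ↑ˡ m) ≡ inj₁ (to σ i)
  verticesThenEdges-↑ˡ i = cong (to (σ ⊎-↔ E)) (Fin.splitAt-↑ˡ n i m)

  verticesThenEdges-↑ʳ : ∀ j → to (verticesThenEdges σ E) (n ↑ʳ j) ≡ inj₂ (to E j)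
  verticesThenEdges-↑ʳ j = cong (to (σ ⊎-↔ E)) (Fin.splitAt-↑ʳ n m j)

module Positions {n m} {G : SimpleGraph n} (E : Fin m ↔ Edge G) (x : CSeq G) where

  vertexPos : Fin n → ℕ
  vertexPos v = pos x (inj₁ v)

  edgePos : Fin m → ℕ
  edgePos j = pos x (inj₂ (to E j))

  endpointPos : Fin m → ℕ
  endpointPos j = pos x (inj₁ (endL (to E j))) + pos x (inj₁ (endR (to E j)))

  private
    reindex : Fin (n + m) ↔ Fin (len x)
    reindex = ↔-sym (seq x) ↔-∘ verticesThenEdges (↔-id _) E

  sum-over-sequence : (h : Elem G → ℕ) →
    ∑[ k < len x ] h (to (seq x) k) ≡ ∑[ v < n ] h (inj₁ v) + ∑[ j < m ] h (inj₂ (to E j))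
  sum-over-sequence h = begin
    ∑[ k < len x ] h (to (seq x) k)                     ≡⟨ sum-permute _ reindex ⟩
    ∑[ i < n + m ] h (to (seq x) (from (seq x) (φ i)))  ≡⟨ sum-cong-≗ (cong h ∘ strictlyInverseˡ (seq x) ∘ φ) ⟩
    ∑[ i < n + m ] h (φ i)                              ≡⟨ sum-splitAt n (h ∘ φ) ⟩
    ∑[ i < n ] h (φ (i ↑ˡ m)) + ∑[ j < m ] h (φ (n ↑ʳ j))
      ≡⟨ cong₂ _+_ (sum-cong-≗ (cong h ∘ verticesThenEdges-↑ˡ (↔-id _) E))
                   (sum-cong-≗ (cong h ∘ verticesThenEdges-↑ʳ (↔-id _) E)) ⟩
    ∑[ v < n ] h (inj₁ v) + ∑[ j < m ] h (inj₂ (to E j)) ∎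
    where
    open ≡-Reasoning
    φ = to (verticesThenEdges (↔-id _) E)

  vertexPos+edgePos : sum vertexPos + sum edgePos ≡ triangular (n + m)
  vertexPos+edgePos = begin
    sum vertexPos + sum edgePos             ≡⟨ sum-over-sequence (pos x) ⟨
    ∑[ k < len x ] pos x (to (seq x) k)     ≡⟨ sum-cong-≗ (cong toℕ ∘ strictlyInverseʳ (seq x)) ⟩
    triangular (len x)                      ≡⟨ cong triangular (↔⇒≡ reindex) ⟨
    triangular (n + m)                      ∎
    where open ≡-Reasoning

  vertexPos-injective : Injective _≡_ _≡_ vertexPos
  vertexPos-injective {u} {v} eq = inj₁-injective (begin
    inj₁ u                             ≡⟨ strictlyInverseˡ (seq x) (inj₁ u) ⟨
    to (seq x) (from (seq x) (inj₁ u)) ≡⟨ cong (to (seq x)) (Fin.toℕ-injective eq) ⟩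
    to (seq x) (from (seq x) (inj₁ v)) ≡⟨ strictlyInverseˡ (seq x) (inj₁ v) ⟩
    inj₁ v                             ∎)
    where open ≡-Reasoning

  edgeCost+endpointPos : ∀ j → elemCost x (inj₂ (to E j)) + endpointPos j ≡ edgePos j + edgePos j
  edgeCost+endpointPos j = trans (regroup (edgePos j ∸ l) (edgePos j ∸ r) l r)
    (cong₂ _+_ (ℕ.m∸n+n≡m (ℕ.<⇒≤ (edgeAfterL x (to E j))))
               (ℕ.m∸n+n≡m (ℕ.<⇒≤ (edgeAfterR x (to E j)))))
    where
    l = pos x (inj₁ (endL (to E j)))
    r = pos x (inj₁ (endR (to E j)))
    regroup : ∀ a b c d → a + b + (c + d) ≡ a + c + (b + d)
    regroup = solve-∀

  cost+endpointPos : cost x + sum endpointPos ≡ sum edgePos + sum edgePos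
  cost+endpointPos = begin
    cost x + sum endpointPos
      ≡⟨ cong (_+ sum endpointPos) (trans (cost≡sum x) (sum-over-sequence (elemCost x))) ⟩
    sum {n} (λ _ → 0) + ∑[ j < m ] elemCost x (inj₂ (to E j)) + sum endpointPos
      ≡⟨ cong (λ z → z + ∑[ j < m ] elemCost x (inj₂ (to E j)) + sum endpointPos) (sum-replicate-zero n) ⟩
    ∑[ j < m ] elemCost x (inj₂ (to E j)) + sum endpointPos
      ≡⟨ ∑-distrib-+ (λ j → elemCost x (inj₂ (to E j))) endpointPos ⟨
    ∑[ j < m ] (elemCost x (inj₂ (to E j)) + endpointPos j)
      ≡⟨ sum-cong-≗ edgeCost+endpointPos ⟩
    ∑[ j < m ] (edgePos j + edgePos j)
      ≡⟨ ∑-distrib-+ edgePos edgePos ⟩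
    sum edgePos + sum edgePos ∎
    where open ≡-Reasoning

  cost-formula : cost x + (sum vertexPos + sum vertexPos + sum endpointPos) ≡
                 triangular (n + m) + triangular (n + m)
  cost-formula = begin
    cost x + (P + P + sum endpointPos)   ≡⟨ regroup (cost x) P (sum endpointPos) ⟩
    cost x + sum endpointPos + (P + P)   ≡⟨ cong (_+ (P + P)) cost+endpointPos ⟩
    Q + Q + (P + P)                      ≡⟨ regroup′ P Q ⟩
    (P + Q) + (P + Q)                    ≡⟨ cong₂ _+_ vertexPos+edgePos vertexPos+edgePos ⟩
    triangular (n + m) + triangular (n + m) ∎
    where
    open ≡-Reasoning
    P = sum vertexPos
    Q = sum edgePos
    regroup : ∀ c p b → c + (p + p + b) ≡ c + b + (p + p)
    regroup = solve-∀
    regroup′ : ∀ p q → q + q + (p + p) ≡ p + q + (p + q)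
    regroup′ = solve-∀

  cost-bound : ∀ d → sum vertexPos + d ≤ sum endpointPos →
    cost x + (triangular n + triangular n + (triangular n + d)) ≤ triangular (n + m) + triangular (n + m)
  cost-bound d P+d≤B = begin
    cost x + (t + t + (t + d))
      ≤⟨ ℕ.+-monoʳ-≤ (cost x) (ℕ.+-mono-≤ (ℕ.+-mono-≤ t≤P t≤P) (ℕ.≤-trans (ℕ.+-monoˡ-≤ d t≤P) P+d≤B)) ⟩
    cost x + (sum vertexPos + sum vertexPos + sum endpointPos) ≡⟨ cost-formula ⟩
    triangular (n + m) + triangular (n + m) ∎
    where
    open ℕ.≤-Reasoning
    t = triangular n
    t≤P = triangular≤sum n vertexPos vertexPos-injective

module _ {n m} {G : SimpleGraph n} (σ : Fin n ↔ Fin n) (E : Fin m ↔ Edge G) where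

  rank : Fin n → ℕ
  rank v = toℕ (from σ v)

  verticesFirst : CSeq G
  verticesFirst = record
    { len        = n + m
    ; seq        = verticesThenEdges σ E
    ; edgeAfterL = λ e → vertex<edge (endL e) e
    ; edgeAfterR = λ e → vertex<edge (endR e) e
    }
    where
    vertex<edge : ∀ v e → toℕ (from σ v ↑ˡ m) < toℕ (n ↑ʳ from E e)
    vertex<edge v e rewrite Fin.toℕ-↑ˡ (from σ v) m | Fin.toℕ-↑ʳ n (from E e) =
      ℕ.<-≤-trans (Fin.toℕ<n (from σ v)) (ℕ.m≤m+n n _)

  verticesFirst-cost : cost verticesFirst +
      (triangular n + triangular n + ∑[ j < m ] (rank (endL (to E j)) + rank (endR (to E j))))
    ≡ triangular (n + m) + triangular (n + m)
  verticesFirst-cost = begin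
    cost verticesFirst + (t + t + ∑[ j < m ] (rank (endL (to E j)) + rank (endR (to E j))))
      ≡⟨ cong (λ b → cost verticesFirst + (t + t + b)) (sum-cong-≗ λ j →
           cong₂ _+_ (Fin.toℕ-↑ˡ (from σ (endL (to E j))) m) (Fin.toℕ-↑ˡ (from σ (endR (to E j))) m)) ⟨
    cost verticesFirst + (t + t + sum endpointPos)
      ≡⟨ cong (λ p → cost verticesFirst + (p + p + sum endpointPos)) vertexPos≡triangular ⟨
    cost verticesFirst + (sum vertexPos + sum vertexPos + sum endpointPos) ≡⟨ cost-formula ⟩
    triangular (n + m) + triangular (n + m) ∎
    where
    open ≡-Reasoning
    open Positions E verticesFirst
    t = triangular n
    vertexPos≡triangular : sum vertexPos ≡ t
    vertexPos≡triangular = trans (sum-cong-≗ λ v → Fin.toℕ-↑ˡ (from σ v) m) (sym (sum-permute toℕ (↔-sym σ)))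

≤-by-complement : ∀ {a b c d s} → a + b ≤ s → c + d ≡ s → d ≤ b → a ≤ c
≤-by-complement {a} {b} {c} {d} a+b≤s refl d≤b =
  ℕ.+-cancelʳ-≤ b a c (ℕ.≤-trans a+b≤s (ℕ.+-monoʳ-≤ c d≤b))

Edge-≡ : ∀ {n} {G : SimpleGraph n} {e e′ : Edge G} → endL e ≡ endL e′ → endR e ≡ endR e′ → e ≡ e′
Edge-≡ {e = edge l r _ _} {edge .l .r _ _} refl refl =
  cong₂ (edge l r) (ℕ.<-irrelevant _ _) (Decidable⇒UIP.≡-irrelevant Bool._≟_ _ _)

-- Stars and paths

module _ (n : ℕ) where

  starEdge : Fin n → Edge (Star (suc n))
  starEdge j = edge fzero (fsuc j) (s≤s z≤n) refl

  starEdges : Fin n ↔ Edge (Star (suc n))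
  starEdges = mk↔ₛ′ starEdge leaf starEdge∘leaf (λ _ → refl)
    where
    leaf : Edge (Star (suc n)) → Fin n
    leaf (edge _ fzero () _)
    leaf (edge _ (fsuc j) _ _) = j
    starEdge∘leaf : ∀ e → starEdge (leaf e) ≡ e
    starEdge∘leaf (edge _ fzero () _)
    starEdge∘leaf (edge fzero (fsuc j) _ _) = Edge-≡ refl refl
    starEdge∘leaf (edge (fsuc _) (fsuc _) _ ())

  -- Every edge of the star has the centre, at rank 0, as an endpoint, so the
  -- endpoint sum of the vertices-first sequence is 0 + 1 + ... + n.
  star-cost : cost (verticesFirst (↔-id _) starEdges) + (triangular (suc n) + triangular (suc n) + triangular (suc n))
    ≡ triangular (suc n + n) + triangular (suc n + n)
  star-cost = verticesFirst-cost (↔-id _) starEdges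

pathAdj⇒suc : ∀ {n} {l r : Fin n} → toℕ l < toℕ r → pathAdj l r ≡ true → suc (toℕ l) ≡ toℕ r
pathAdj⇒suc {l = l} {r} l<r adj-lr with suc (toℕ l) ℕ.≟ toℕ r | suc (toℕ r) ℕ.≟ toℕ l
... | yes l+1≡r | _        = l+1≡r
... | no  _     | yes r+1≡l = contradiction (subst (toℕ r <_) r+1≡l (ℕ.n<1+n (toℕ r))) (ℕ.<-asym l<r)
... | no  _     | no  _     = contradiction adj-lr λ ()

module _ (k : ℕ) where

  pathEdge : Fin (suc k) → Edge (Path (suc (suc k)))
  pathEdge j = edge (inject₁ j) (fsuc j) (ℕ.≤-reflexive (cong suc (Fin.toℕ-inject₁ j))) (adj-j j)
    where
    adj-j : ∀ j → pathAdj (inject₁ j) (fsuc j) ≡ true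
    adj-j j with suc (toℕ (inject₁ j)) ℕ.≟ toℕ (fsuc j)
    ... | yes _  = refl
    ... | no j≠j = contradiction (cong suc (Fin.toℕ-inject₁ j)) j≠j

  pathEdges : Fin (suc k) ↔ Edge (Path (suc (suc k)))
  pathEdges = mk↔ₛ′ pathEdge leftEnd pathEdge∘leftEnd leftEnd∘pathEdge
    where
    leftEnd<suc-k : ∀ e → toℕ (endL e) < suc k
    leftEnd<suc-k e = ℕ.<-≤-trans (ordered e) (s≤s⁻¹ (Fin.toℕ<n (endR e)))
    leftEnd : Edge (Path (suc (suc k))) → Fin (suc k)
    leftEnd e = fromℕ< (leftEnd<suc-k e)
    toℕ-leftEnd : ∀ e → toℕ (inject₁ (leftEnd e)) ≡ toℕ (endL e)
    toℕ-leftEnd e = trans (Fin.toℕ-inject₁ _) (Fin.toℕ-fromℕ< (leftEnd<suc-k e))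
    pathEdge∘leftEnd : ∀ e → pathEdge (leftEnd e) ≡ e
    pathEdge∘leftEnd e = Edge-≡ (Fin.toℕ-injective (toℕ-leftEnd e))
      (Fin.toℕ-injective (trans (cong suc (Fin.toℕ-fromℕ< (leftEnd<suc-k e))) (pathAdj⇒suc (ordered e) (isAdj e))))
    leftEnd∘pathEdge : ∀ j → leftEnd (pathEdge j) ≡ j
    leftEnd∘pathEdge j = Fin.toℕ-injective (trans (Fin.toℕ-fromℕ< _) (Fin.toℕ-inject₁ j))

  -- The inner vertices 1, ..., k are endpoints of two edges each.
  path-endpointPos : ∀ x → let open Positions pathEdges x in
    sum vertexPos + triangular k ≤ sum endpointPos
  path-endpointPos x = begin
    sum vertexPos + triangular k    ≤⟨ ℕ.+-monoʳ-≤ (sum vertexPos) (triangular≤sum k inner inner-injective) ⟩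
    sum vertexPos + sum inner       ≡⟨ regroup (vertexPos fzero) (sum inner) (∑[ j < suc k ] vertexPos (fsuc j)) ⟩
    ∑[ j < suc k ] vertexPos (inject₁ j) + ∑[ j < suc k ] vertexPos (fsuc j)
                                    ≡⟨ ∑-distrib-+ (vertexPos ∘ inject₁) (vertexPos ∘ fsuc) ⟨
    sum endpointPos                 ∎
    where
    open ℕ.≤-Reasoning
    open Positions pathEdges x
    inner : Fin k → ℕ
    inner j = vertexPos (fsuc (inject₁ j))
    inner-injective : Injective _≡_ _≡_ inner
    inner-injective = Fin.inject₁-injective ∘ Fin.suc-injective ∘ vertexPos-injective
    regroup : ∀ a b c → a + c + b ≡ a + b + c
    regroup = solve-∀

  path-cost-bound : ∀ x → cost x + (triangular (2 + k) + triangular (2 + k) + (triangular (2 + k) + triangular k))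
    ≤ triangular (2 + k + suc k) + triangular (2 + k + suc k)
  path-cost-bound x = cost-bound (triangular k) (path-endpointPos x)
    where open Positions pathEdges x

-- Leaves of trees

removeVertex : ∀ {n} → SimpleGraph (suc n) → Fin (suc n) → SimpleGraph n
removeVertex G v = record
  { adj   = λ i j → adj G (punchIn v i) (punchIn v j)
  ; sym   = λ i j → SimpleGraph.sym G (punchIn v i) (punchIn v j)
  ; irref = λ i → irref G (punchIn v i)
  }

record Leaf {n} (G : SimpleGraph n) (v : Fin n) : Set where
  field
    neighbour      : Fin n
    adj-neighbour  : adj G v neighbour ≡ true
    only-neighbour : ∀ z → adj G v z ≡ true → z ≡ neighbour

adj⇒≢ : ∀ {n} (G : SimpleGraph n) {u v} → adj G u v ≡ true → u ≢ v
adj⇒≢ G {u} adj-uv refl = contradiction (trans (sym adj-uv) (irref G u)) λ ()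

module _ {n} (G : SimpleGraph (suc n)) (v : Fin (suc n)) where

  adjChain-punchIn : ∀ a bs z → adjChain (removeVertex G v) a bs z →
    adjChain G (punchIn v a) (List.map (punchIn v) bs) (punchIn v z)
  adjChain-punchIn a []       z adj-az           = adj-az
  adjChain-punchIn a (b ∷ bs) z (adj-ab , chain) = adj-ab , adjChain-punchIn b bs z chain

  removeVertex-acyclic : Acyclic G → Acyclic (removeVertex G v)
  removeVertex-acyclic acyclic (c , bs , 2≤len , unique , chain) = acyclic
    ( punchIn v c , List.map (punchIn v) bs
    , subst (2 ≤_) (sym (List.length-map (punchIn v) bs)) 2≤len
    , Unique.map⁺ (Fin.punchIn-injective v _ _) unique
    , adjChain-punchIn c bs c chain )

  -- A walk of G between vertices other than the leaf v enters v only to come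
  -- straight back to its unique neighbour, so that detour can be cut out.
  removeLeaf-walk : Leaf G v → ∀ {a b} → Walk G a b →
    ∀ x y → punchIn v x ≡ a → punchIn v y ≡ b → Walk (removeVertex G v) x y
  removeLeaf-walk leaf here x y x≡a y≡a =
    subst (Walk _ x) (Fin.punchIn-injective v x y (trans x≡a (sym y≡a))) here
  removeLeaf-walk leaf (step {v = c} adj-ac walk) x y x≡a y≡b with c Fin.≟ v
  ... | no c≢v = step (trans (cong₂ (adj G) x≡a (Fin.punchIn-punchOut v≢c)) adj-ac)
                      (removeLeaf-walk leaf walk (punchOut v≢c) y (Fin.punchIn-punchOut v≢c) y≡b)
    where v≢c = c≢v ∘ sym
  removeLeaf-walk leaf (step adj-av here) x y x≡a y≡v | yes refl =
    contradiction y≡v (Fin.punchInᵢ≢i v y)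
  removeLeaf-walk leaf (step {u = a} adj-av (step {v = d} adj-vd walk)) x y x≡a y≡b | yes refl =
    removeLeaf-walk leaf walk x y (trans x≡a (trans a≡u (sym (only-neighbour d adj-vd)))) y≡b
    where
    open Leaf leaf
    a≡u = only-neighbour a (trans (SimpleGraph.sym G v a) adj-av)

  removeLeaf-connected : Leaf G v → Connected G → Connected (removeVertex G v)
  removeLeaf-connected leaf connected x y =
    removeLeaf-walk leaf (connected (punchIn v x) (punchIn v y)) x y refl refl

punchOutAll : ∀ {M} (x : Fin (suc M)) (xs : List (Fin (suc M))) → All (x ≢_) xs → List (Fin M)
punchOutAll x []       []           = []
punchOutAll x (y ∷ ys) (x≢y ∷ x≢ys) = punchOut x≢y ∷ punchOutAll x ys x≢ys

length-punchOutAll : ∀ {M} x xs x≢xs → List.length (punchOutAll {M} x xs x≢xs) ≡ List.length xs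
length-punchOutAll x []       []           = refl
length-punchOutAll x (y ∷ ys) (x≢y ∷ x≢ys) = cong suc (length-punchOutAll x ys x≢ys)

punchOutAll-unique : ∀ {M} x xs x≢xs → Unique xs → Unique (punchOutAll {M} x xs x≢xs)
punchOutAll-unique x []       []           []                  = []
punchOutAll-unique x (y ∷ ys) (x≢y ∷ x≢ys) (y≢ys ∷ unique-ys) =
  distinct ys x≢ys y≢ys ∷ punchOutAll-unique x ys x≢ys unique-ys
  where
  distinct : ∀ zs x≢zs → All (y ≢_) zs → All (punchOut x≢y ≢_) (punchOutAll x zs x≢zs)
  distinct []       []           []           = []
  distinct (z ∷ zs) (x≢z ∷ x≢zs) (y≢z ∷ y≢zs) =
    (y≢z ∘ Fin.punchOut-injective x≢y x≢z) ∷ distinct zs x≢zs y≢zs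

unique⇒length≤ : ∀ {M} (xs : List (Fin M)) → Unique xs → List.length xs ≤ M
unique⇒length≤         []       _                 = z≤n
unique⇒length≤ {zero}  (() ∷ _) _
unique⇒length≤ {suc M} (x ∷ xs) (x≢xs ∷ unique-xs) = s≤s (subst (_≤ M) (length-punchOutAll x xs x≢xs)
  (unique⇒length≤ (punchOutAll x xs x≢xs) (punchOutAll-unique x xs x≢xs unique-xs)))

Unique-++⁻ˡ : ∀ {A : Set} (xs ys : List A) → Unique (xs List.++ ys) → Unique xs
Unique-++⁻ˡ []       ys _                 = []
Unique-++⁻ˡ (x ∷ xs) ys (x≢xs ∷ unique-xs) = All.++⁻ˡ xs x≢xs ∷ Unique-++⁻ˡ xs ys unique-xs

Linked : ∀ {n} → SimpleGraph n → List (Fin n) → Set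
Linked G []           = ⊤
Linked G (a ∷ [])     = ⊤
Linked G (a ∷ b ∷ as) = (adj G a b ≡ true) × Linked G (b ∷ as)

Linked⇒adjChain : ∀ {n} (G : SimpleGraph n) a pre z suf c →
  Linked G (a ∷ pre List.++ z ∷ suf) → adj G z c ≡ true → adjChain G a (pre List.++ z ∷ []) c
Linked⇒adjChain G a []        z suf c (adj-az , _)      adj-zc = adj-az , adj-zc
Linked⇒adjChain G a (b ∷ pre) z suf c (adj-ab , linked) adj-zc =
  adj-ab , Linked⇒adjChain G b pre z suf c linked adj-zc

-- Grow a path away from w at its head x until x has no neighbour besides its
-- predecessor y.  A neighbour further back on the path would close a cycle, and
-- the path cannot outgrow the vertex set.
module LeafSearch {k} (T : SimpleGraph (suc (suc k))) (tree : IsTree T) (w : Fin (suc (suc k))) where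

  private
    M = suc (suc k)
  open import Data.List.Membership.DecPropositional (Fin._≟_ {M}) using (_∈?_)

  no-chord : ∀ x y rest z → Linked T (x ∷ y ∷ rest) → Unique (x ∷ y ∷ rest) →
    z ∈ rest → adj T x z ≡ true → ⊥
  no-chord x y rest z (adj-xy , linked) unique z∈rest adj-xz with ∈-∃++ z∈rest
  ... | pre , suf , refl = proj₂ tree
    ( x , y ∷ pre List.++ z ∷ []
    , s≤s (subst (1 ≤_) (sym (List.length-++ pre)) (ℕ.m≤n+m 1 (List.length pre)))
    , Unique-++⁻ˡ (x ∷ y ∷ pre List.++ z ∷ []) suf
        (subst (λ l → Unique (x ∷ y ∷ l)) (sym (List.++-assoc pre (z ∷ []) suf)) unique)
    , adj-xy , Linked⇒adjChain T y pre z suf x linked (trans (SimpleGraph.sym T z x) adj-xz) )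

  grow : ∀ fuel x y rest → M < List.length (x ∷ y ∷ rest) + fuel →
    Linked T (x ∷ y ∷ rest) → Unique (x ∷ y ∷ rest) → w ∈ y ∷ rest →
    Σ (Fin M) λ v → v ≢ w × Leaf T v
  grow zero x y rest M<len _ unique _ = contradiction
    (unique⇒length≤ _ unique) (ℕ.<⇒≱ (subst (M <_) (ℕ.+-identityʳ _) M<len))
  grow (suc fuel) x y rest M<len linked unique@(x∉path ∷ _) w∈path
    with Fin.any? (λ z → (adj T x z Bool.≟ true) ×-dec ¬? (z Fin.≟ y))
  ... | no none = x , (λ { refl → lookup x∉path w∈path refl }) , record
    { neighbour = y ; adj-neighbour = proj₁ linked ; only-neighbour = only-y }
    where
    only-y : ∀ z → adj T x z ≡ true → z ≡ y
    only-y z adj-xz with z Fin.≟ y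
    ... | yes z≡y = z≡y
    ... | no  z≢y = contradiction (z , adj-xz , z≢y) none
  ... | yes (z , adj-xz , z≢y) with z ∈? rest
  ...   | yes z∈rest = contradiction adj-xz (no-chord x y rest z linked unique z∈rest)
  ...   | no  z∉rest = grow fuel z x (y ∷ rest) (subst (M <_) (ℕ.+-suc _ fuel) M<len)
      (trans (SimpleGraph.sym T z x) adj-xz , linked)
      ((adj⇒≢ T (trans (SimpleGraph.sym T z x) adj-xz) ∷ z≢y ∷ All.¬Any⇒All¬ rest z∉rest) ∷ unique)
      (there w∈path)

  leaf≢ : Σ (Fin M) λ v → v ≢ w × Leaf T v
  leaf≢ = start (proj₁ tree w (punchIn w fzero)) (Fin.punchInᵢ≢i w fzero)
    where
    start : ∀ {t} → Walk T w t → t ≢ w → Σ (Fin M) λ v → v ≢ w × Leaf T v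
    start here                  t≢w = contradiction refl t≢w
    start (step {v = x} adj-wx _) _ = grow M x w [] (ℕ.m<n+m M {2} (s≤s z≤n))
      (trans (SimpleGraph.sym T x w) adj-wx , tt)
      ((adj⇒≢ T (trans (SimpleGraph.sym T x w) adj-wx) ∷ []) ∷ [] ∷ []) (here refl)

-- Pruning orders

punchIn-mono-< : ∀ {n} (i : Fin (suc n)) {j k : Fin n} → j <ᶠ k → punchIn i j <ᶠ punchIn i k
punchIn-mono-< i {j} {k} j<k = ℕ.≰⇒> (ℕ.<⇒≱ j<k ∘ Fin.punchIn-cancel-≤ i k j)

punchOut-mono-< : ∀ {n} {i j k : Fin (suc n)} (i≢j : i ≢ j) (i≢k : i ≢ k) →
  j <ᶠ k → punchOut i≢j <ᶠ punchOut i≢k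
punchOut-mono-< i≢j i≢k j<k = ℕ.≰⇒> (ℕ.<⇒≱ j<k ∘ Fin.punchOut-cancel-≤ i≢k i≢j)

data Joins {n} {G : SimpleGraph n} (e : Edge G) (a b : Fin n) : Set where
  forwards  : endL e ≡ a → endR e ≡ b → Joins e a b
  backwards : endL e ≡ b → endR e ≡ a → Joins e a b

module _ {n} {G : SimpleGraph n} where

  Joins-unique : ∀ {e e′ : Edge G} {a b} → Joins e a b → Joins e′ a b → e ≡ e′
  Joins-unique (forwards  l r) (forwards  l′ r′) = Edge-≡ (trans l (sym l′)) (trans r (sym r′))
  Joins-unique (backwards l r) (backwards l′ r′) = Edge-≡ (trans l (sym l′)) (trans r (sym r′))
  Joins-unique {e} {e′} (forwards refl refl) (backwards l′ r′) =
    contradiction (subst₂ _<ᶠ_ l′ r′ (ordered e′)) (ℕ.<-asym (ordered e))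
  Joins-unique {e} {e′} (backwards refl refl) (forwards l′ r′) =
    contradiction (subst₂ _<ᶠ_ l′ r′ (ordered e′)) (ℕ.<-asym (ordered e))

  edgeJoining : ∀ {a b} → adj G a b ≡ true → Σ (Edge G) λ e → Joins e a b
  edgeJoining {a} {b} adj-ab with Fin.<-cmp a b
  ... | tri< a<b _ _ = edge a b a<b adj-ab , forwards refl refl
  ... | tri≈ _ refl _ = contradiction refl (adj⇒≢ G adj-ab)
  ... | tri> _ _ b<a = edge b a b<a (trans (SimpleGraph.sym G b a) adj-ab) , backwards refl refl

  Joins-sum : ∀ (f : Fin n → ℕ) {e : Edge G} {a b} → Joins e a b → f (endL e) + f (endR e) ≡ f a + f b
  Joins-sum f (forwards  refl refl) = refl
  Joins-sum f (backwards refl refl) = ℕ.+-comm (f _) (f _)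

-- The tree is pruned leaf by leaf, the vertex of index j being removed with the
-- edge j to its parent; only the last vertex (index n) remains.  Listed in reverse,
-- parent-late keeps the parents' ranks small.
record PruningOrder {n} (T : SimpleGraph (suc n)) : Set where
  field
    vertexAt     : Fin (suc n) ↔ Fin (suc n)
    edgeAt       : Fin n ↔ Edge T
    parent       : Fin n → Fin (suc n)
    edgeAt-joins : ∀ j → Joins (to edgeAt j) (to vertexAt (inject₁ j)) (to vertexAt (parent j))
    parent-late  : ∀ j → 2 + toℕ j ≤ toℕ (parent j) ⊎ parent j ≡ fromℕ n

parent-late-first : ∀ {n} (r : Fin (suc n)) → n ≡ 0 ⊎ r ≢ fzero →
  2 ≤ toℕ (fsuc r) ⊎ fsuc r ≡ fromℕ (suc n)
parent-late-first {zero}  fzero    _            = inj₂ refl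
parent-late-first {suc n} fzero    (inj₁ ())
parent-late-first {suc n} fzero    (inj₂ r≢0)   = contradiction refl r≢0
parent-late-first         (fsuc r) _            = inj₁ (s≤s (s≤s z≤n))

module Prune {n} (T : SimpleGraph (suc (suc n))) (v : Fin (suc (suc n))) (leaf : Leaf T v) where

  open Leaf leaf renaming (neighbour to u)

  v≢u : v ≢ u
  v≢u = adj⇒≢ T adj-neighbour

  u′ : Fin (suc n)
  u′ = punchOut v≢u

  module _ (order′ : PruningOrder (removeVertex T v)) where
    open PruningOrder order′ renaming
      (vertexAt to vertexAt′; edgeAt to edgeAt′; parent to parent′; edgeAt-joins to edgeAt′-joins; parent-late to parent′-late)

    vertexAt : Fin (suc (suc n)) ↔ Fin (suc (suc n))
    vertexAt = insert fzero v vertexAt′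

    liftEdge : Edge (removeVertex T v) → Edge T
    liftEdge e = edge (punchIn v (endL e)) (punchIn v (endR e)) (punchIn-mono-< v (ordered e)) (isAdj e)

    lowerEdge : (e : Edge T) → v ≢ endL e → v ≢ endR e → Edge (removeVertex T v)
    lowerEdge e v≢l v≢r = edge (punchOut v≢l) (punchOut v≢r) (punchOut-mono-< v≢l v≢r (ordered e))
      (trans (cong₂ (adj T) (Fin.punchIn-punchOut v≢l) (Fin.punchIn-punchOut v≢r)) (isAdj e))

    leafEdge : Edge T
    leafEdge = proj₁ (edgeJoining adj-neighbour)

    leafEdge-joins : Joins leafEdge v u
    leafEdge-joins = proj₂ (edgeJoining adj-neighbour)

    toEdge : Fin (suc n) → Edge T
    toEdge fzero    = leafEdge
    toEdge (fsuc j) = liftEdge (to edgeAt′ j)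

    fromEdge : Edge T → Fin (suc n)
    fromEdge e with v Fin.≟ endL e | v Fin.≟ endR e
    ... | yes _   | _       = fzero
    ... | no _    | yes _   = fzero
    ... | no v≢l  | no v≢r  = fsuc (from edgeAt′ (lowerEdge e v≢l v≢r))

    toEdge∘fromEdge : ∀ e → toEdge (fromEdge e) ≡ e
    toEdge∘fromEdge e with v Fin.≟ endL e | v Fin.≟ endR e
    ... | yes refl | _        = Joins-unique leafEdge-joins (forwards refl (only-neighbour _ (isAdj e)))
    ... | no _     | yes refl =
      Joins-unique leafEdge-joins (backwards (only-neighbour _ (trans (SimpleGraph.sym T v _) (isAdj e))) refl)
    ... | no v≢l   | no v≢r   = trans (cong liftEdge (strictlyInverseˡ edgeAt′ _))
      (Edge-≡ (Fin.punchIn-punchOut v≢l) (Fin.punchIn-punchOut v≢r))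

    fromEdge-incident : ∀ e → v ≡ endL e ⊎ v ≡ endR e → fromEdge e ≡ fzero
    fromEdge-incident e v∈e with v Fin.≟ endL e | v Fin.≟ endR e | v∈e
    ... | yes _   | _       | _          = refl
    ... | no _    | yes _   | _          = refl
    ... | no v≢l  | no _    | inj₁ v≡l   = contradiction v≡l v≢l
    ... | no _    | no v≢r  | inj₂ v≡r   = contradiction v≡r v≢r

    fromEdge-liftEdge : ∀ e → fromEdge (liftEdge e) ≡ fsuc (from edgeAt′ e)
    fromEdge-liftEdge e with v Fin.≟ punchIn v (endL e) | v Fin.≟ punchIn v (endR e)
    ... | yes v≡l | _       = contradiction (sym v≡l) (Fin.punchInᵢ≢i v _)
    ... | no _    | yes v≡r = contradiction (sym v≡r) (Fin.punchInᵢ≢i v _)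
    ... | no _    | no _    = cong (fsuc ∘ from edgeAt′) (Edge-≡ (Fin.punchOut-punchIn v) (Fin.punchOut-punchIn v))

    fromEdge∘toEdge : ∀ j → fromEdge (toEdge j) ≡ j
    fromEdge∘toEdge fzero    = fromEdge-incident leafEdge (v-incident leafEdge-joins)
      where
      v-incident : ∀ {e} → Joins e v u → v ≡ endL e ⊎ v ≡ endR e
      v-incident (forwards  l _) = inj₁ (sym l)
      v-incident (backwards _ r) = inj₂ (sym r)
    fromEdge∘toEdge (fsuc j) = trans (fromEdge-liftEdge (to edgeAt′ j)) (cong fsuc (strictlyInverseʳ edgeAt′ j))

    parent : Fin (suc n) → Fin (suc (suc n))
    parent fzero    = fsuc (from vertexAt′ u′)
    parent (fsuc j) = fsuc (parent′ j)

    vertexAt-suc : ∀ r → to vertexAt (fsuc r) ≡ punchIn v (to vertexAt′ r)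
    vertexAt-suc = insert-punchIn fzero v vertexAt′

    edgeAt-joins : ∀ j → Joins (toEdge j) (to vertexAt (inject₁ j)) (to vertexAt (parent j))
    edgeAt-joins fzero    = subst (Joins leafEdge v) (sym u-at-parent) leafEdge-joins
      where
      u-at-parent : to vertexAt (parent fzero) ≡ u
      u-at-parent = trans (vertexAt-suc _)
        (trans (cong (punchIn v) (strictlyInverseˡ vertexAt′ u′)) (Fin.punchIn-punchOut v≢u))
    edgeAt-joins (fsuc j) = subst₂ (Joins (toEdge (fsuc j))) (sym (vertexAt-suc _)) (sym (vertexAt-suc _))
      (liftJoins (edgeAt′-joins j))
      where
      liftJoins : ∀ {e a b} → Joins e a b → Joins (liftEdge e) (punchIn v a) (punchIn v b)
      liftJoins (forwards  refl refl) = forwards  refl refl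
      liftJoins (backwards refl refl) = backwards refl refl

    order : n ≡ 0 ⊎ to vertexAt′ fzero ≢ u′ → PruningOrder T
    order first≢u′ = record
      { vertexAt     = vertexAt
      ; edgeAt       = mk↔ₛ′ toEdge fromEdge toEdge∘fromEdge fromEdge∘toEdge
      ; parent       = parent
      ; edgeAt-joins = edgeAt-joins
      ; parent-late  = λ
        { fzero    → parent-late-first (from vertexAt′ u′) (Sum.map₂ u′-not-first first≢u′)
        ; (fsuc j) → Sum.map s≤s (cong fsuc) (parent′-late j) }
      }
      where
      u′-not-first : to vertexAt′ fzero ≢ u′ → from vertexAt′ u′ ≢ fzero
      u′-not-first first≢u′ u′-first =
        first≢u′ (trans (cong (to vertexAt′) (sym u′-first)) (strictlyInverseˡ vertexAt′ u′))

singletonOrder : (T : SimpleGraph 1) → PruningOrder T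
singletonOrder T = record
  { vertexAt     = ↔-id _
  ; edgeAt       = mk↔ₛ′ (λ ()) noEdge (λ e → contradiction (noEdge e) λ ()) (λ ())
  ; parent       = λ ()
  ; edgeAt-joins = λ ()
  ; parent-late  = λ ()
  }
  where
  noEdge : Edge T → Fin 0
  noEdge (edge fzero fzero () _)

-- Asking the first pruned vertex to differ from a given w lets the recursion ensure
-- that the neighbour of the leaf it prunes first is not pruned second.
pruningOrder : ∀ n (T : SimpleGraph (suc n)) → IsTree T → (w : Fin (suc n)) →
  Σ (PruningOrder T) λ order → n ≡ 0 ⊎ to (PruningOrder.vertexAt order) fzero ≢ w
pruningOrder zero    T _    w = singletonOrder T , inj₁ refl
pruningOrder (suc n) T tree w with LeafSearch.leaf≢ T tree w
... | v , v≢w , leaf = Prune.order T v leaf (proj₁ order′) (proj₂ order′) , inj₂ v≢w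
  where
  tree′ : IsTree (removeVertex T v)
  tree′ = removeLeaf-connected T v leaf (proj₁ tree) , removeVertex-acyclic T v (proj₂ tree)
  order′ = pruningOrder n (removeVertex T v) tree′ (Prune.u′ T v leaf)

treePruningOrder : ∀ {n} {T : SimpleGraph (suc n)} → IsTree T → PruningOrder T
treePruningOrder {n} {T} tree = proj₁ (pruningOrder n T tree fzero)

module _ {k} (T : SimpleGraph (suc (suc k))) (order : PruningOrder T) where

  open PruningOrder order

  parent-last : parent (fromℕ k) ≡ fromℕ (suc k)
  parent-last with parent-late (fromℕ k)
  ... | inj₂ p≡root = p≡root
  ... | inj₁ 2+k≤p  = contradiction (Fin.toℕ<n (parent (fromℕ k)))
    (ℕ.≤⇒≯ (subst (λ z → 2 + z ≤ toℕ (parent (fromℕ k))) (Fin.toℕ-fromℕ k) 2+k≤p))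

  -- Every vertex but the root is the child end of its own edge, and the root is
  -- the parent end of the last edge.
  tree-endpointPos : ∀ x → let open Positions edgeAt x in sum vertexPos ≤ sum endpointPos
  tree-endpointPos x = begin
    sum vertexPos                                   ≡⟨ sum-permute vertexPos vertexAt ⟩
    ∑[ r < suc (suc k) ] vertexPos (to vertexAt r)  ≡⟨ sum-init-last (vertexPos ∘ to vertexAt) ⟩
    sum child + vertexPos (to vertexAt (fromℕ (suc k)))
      ≡⟨ cong (λ r → sum child + vertexPos (to vertexAt r)) parent-last ⟨
    sum child + parentPos (fromℕ k)                 ≤⟨ ℕ.+-monoʳ-≤ (sum child) (≤-sum parentPos (fromℕ k)) ⟩
    sum child + sum parentPos                       ≡⟨ ∑-distrib-+ child parentPos ⟨
    ∑[ j < suc k ] (child j + parentPos j)          ≡⟨ sum-cong-≗ (λ j → Joins-sum vertexPos (edgeAt-joins j)) ⟨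
    sum endpointPos                                 ∎
    where
    open ℕ.≤-Reasoning
    open Positions edgeAt x
    child parentPos : Fin (suc k) → ℕ
    child j = vertexPos (to vertexAt (inject₁ j))
    parentPos j = vertexPos (to vertexAt (parent j))

  tree-cost-bound : ∀ x → cost x + (triangular (2 + k) + triangular (2 + k) + triangular (2 + k))
    ≤ triangular (2 + k + suc k) + triangular (2 + k + suc k)
  tree-cost-bound x = subst (λ z → cost x + (t + t + z) ≤ full + full) (ℕ.+-identityʳ t)
    (cost-bound 0 (subst (_≤ sum endpointPos) (sym (ℕ.+-identityʳ _)) (tree-endpointPos x)))
    where
    open Positions edgeAt x
    t = triangular (2 + k)
    full = triangular (2 + k + suc k)

  reversePruning : Fin (suc (suc k)) ↔ Fin (suc (suc k))
  reversePruning = vertexAt ↔-∘ reverse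

  parentRanks : ℕ
  parentRanks = ∑[ j < suc k ] (suc k ∸ toℕ (parent j))

  parentRanks≤ : parentRanks ≤ triangular k
  parentRanks≤ = ℕ.≤-trans (sum-mono-≤ rank≤) (ℕ.≤-reflexive (sum-complement-suc k))
    where
    rank≤ : ∀ j → suc k ∸ toℕ (parent j) ≤ k ∸ suc (toℕ j)
    rank≤ j with parent-late j
    ... | inj₁ 2+j≤p  = ℕ.∸-monoʳ-≤ (suc k) 2+j≤p
    ... | inj₂ p≡root = ℕ.≤-trans (ℕ.≤-reflexive (trans (cong (λ p → suc k ∸ toℕ p) p≡root)
      (trans (cong (suc k ∸_) (Fin.toℕ-fromℕ (suc k))) (ℕ.n∸n≡0 (suc k))))) z≤n

  -- In reverse pruning order only the root has rank 0, and it is no child end.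
  reversePruning-cost : cost (verticesFirst reversePruning edgeAt) +
      (triangular (2 + k) + triangular (2 + k) + (triangular (2 + k) + parentRanks))
    ≡ triangular (2 + k + suc k) + triangular (2 + k + suc k)
  reversePruning-cost = subst (λ b → cost (verticesFirst reversePruning edgeAt) + (t + t + b) ≡ full + full)
    endpointRanks (verticesFirst-cost reversePruning edgeAt)
    where
    t = triangular (2 + k)
    full = triangular (2 + k + suc k)
    rank′ = rank reversePruning edgeAt
    rank-at : ∀ r → rank′ (to vertexAt r) ≡ suc k ∸ toℕ r
    rank-at r = trans (cong (toℕ ∘ opposite) (strictlyInverseʳ vertexAt r)) (Fin.opposite-prop r)
    endpointRanks : ∑[ j < suc k ] (rank′ (endL (to edgeAt j)) + rank′ (endR (to edgeAt j))) ≡ t + parentRanks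
    endpointRanks = begin
      ∑[ j < suc k ] (rank′ (endL (to edgeAt j)) + rank′ (endR (to edgeAt j)))
        ≡⟨ sum-cong-≗ (λ j → Joins-sum rank′ (edgeAt-joins j)) ⟩
      ∑[ j < suc k ] (rank′ (to vertexAt (inject₁ j)) + rank′ (to vertexAt (parent j)))
        ≡⟨ sum-cong-≗ (λ j → cong₂ _+_ (trans (rank-at (inject₁ j)) (cong (suc k ∸_) (Fin.toℕ-inject₁ j))) (rank-at (parent j))) ⟩
      ∑[ j < suc k ] ((suc k ∸ toℕ j) + (suc k ∸ toℕ (parent j)))
        ≡⟨ ∑-distrib-+ (λ j → suc k ∸ toℕ j) (λ j → suc k ∸ toℕ (parent j)) ⟩
      ∑[ j < suc k ] (suc k ∸ toℕ j) + parentRanks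
        ≡⟨ cong (_+ parentRanks) (sum-complement (suc k)) ⟩
      t + parentRanks ∎
      where open ≡-Reasoning

cost-singleton : {G : SimpleGraph 1} (x : CSeq G) → cost x ≡ 0
cost-singleton {G} x = trans (sym (ℕ.+-identityʳ (cost x)))
  (Positions.cost+endpointPos (PruningOrder.edgeAt (singletonOrder G)) x)

theorem4 : ∀ (k : ℕ) (T : SimpleGraph (suc k)) → IsTree T →
    ∀ (a b c : ℕ) → IsMaxCost (Path (suc k)) a → IsMaxCost T b → IsMaxCost (Star (suc k)) c →
    (a ≤ b) × (b ≤ c)
theorem4 zero T _ _ _ c ((xa , refl) , _) ((xb , refl) , _) _ =
  subst (_≤ cost xb) (sym (cost-singleton xa)) z≤n , subst (_≤ c) (sym (cost-singleton xb)) z≤n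
theorem4 (suc k) T tree _ _ _ ((xa , refl) , _) ((xb , refl) , tree-max) (_ , star-max) =
  ℕ.≤-trans path≤pruned (tree-max (verticesFirst (reversePruning T order) edgeAt)) ,
  ℕ.≤-trans tree≤star (star-max (verticesFirst (↔-id _) (starEdges (suc k))))
  where
  order = treePruningOrder tree
  open PruningOrder order using (edgeAt)
  t = triangular (2 + k)
  path≤pruned : cost xa ≤ cost (verticesFirst (reversePruning T order) edgeAt)
  path≤pruned = ≤-by-complement (path-cost-bound k xa) (reversePruning-cost T order)
    (ℕ.+-monoʳ-≤ (t + t) (ℕ.+-monoʳ-≤ t (parentRanks≤ T order)))
  tree≤star : cost xb ≤ cost (verticesFirst (↔-id _) (starEdges (suc k)))
  tree≤star = ≤-by-complement (tree-cost-bound T order xb) (star-cost (suc k)) ℕ.≤-refl
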